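{- Let $n\ge1$, let $0 = W_0 < W_1 < \cdots < W_n$ be real numbers, and let $B = [0,W_1]\times\cdots\times[0,W_n]$. For $\pi \in S_n$ let $C_{\pi} = \{x \in B : x_{\pi(1)} \geq \cdots \geq x_{\pi(n)}\}$. For $\rho = (\rho_1,\ldots,\rho_n) \in \{1,\ldots,n\}^n$ let $B_{\rho} = (W_{\rho_1-1}, W_{\rho_1}) \times \cdots \times (W_{\rho_n-1}, W_{\rho_n})$, and define $\lambda = (\lambda_1,\ldots,\lambda_n)$ by $\lambda_i = \rho_{\pi(i)}$. Let \[ \lambda^{\max}(\pi) = \bigcup \{\mu \;:\; \mu = (\mu_1 \ge \cdots \ge \mu_n) \text{ is a partition with } n \text{ positive parts and } \mu_i \leq \pi(i) \text{ for all } i\}, \] where $\bigcup$ denotes union of Young diagrams (the least upper bound in Young's lattice). Then $C_{\pi} \cap B_{\rho} \ne \emptyset$ if and only if $\lambda$ is a partition (i.e. $\lambda_1 \ge \cdots \ge \lambda_n$) and $\lambda \subseteq \lambda^{\max}(\pi)$ as Young diagrams. -}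

module Defs where

open import Level using (Level)
open import Data.Nat using (ℕ; suc) renaming (_≤_ to _≤ℕ_; _<_ to _<ℕ_)
open import Data.Fin as Fin using (Fin; zero; suc; toℕ; inject₁)
open import Data.Fin.Permutation using (Permutation′; _⟨$⟩ʳ_)
open import Data.Product using (Σ; _×_; ∃-syntax)
open import Relation.Binary.Bundles using (DenseLinearOrder)
import Relation.Binary.Construct.StrictToNonStrict as StrictToNonStrict

-- Young diagrams with (at most) n rows, given by their row lengths.
-- Rows are indexed by Fin n (row i = row i+1 of the paper), columns by ℕ
-- (0-based).

IsPartition : ∀ {n} → (Fin n → ℕ) → Set
IsPartition μ = ∀ i j → i Fin.≤ j → μ j ≤ℕ μ i

PositiveParts : ∀ {n} → (Fin n → ℕ) → Set
PositiveParts μ = ∀ i → 1 ≤ℕ μ i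

_∈YD_ : ∀ {n} → Fin n × ℕ → (Fin n → ℕ) → Set
(i Data.Product., j) ∈YD μ = j <ℕ μ i

_∈⋃_ : ∀ {n} → Fin n × ℕ → ((Fin n → ℕ) → Set) → Set
c ∈⋃ S = Σ (_ → ℕ) λ μ → S μ × (c ∈YD μ)

_⊆⋃_ : ∀ {n} → (Fin n → ℕ) → ((Fin n → ℕ) → Set) → Set
lam ⊆⋃ S = ∀ c → c ∈YD lam → c ∈⋃ S

-- the family whose union is λ^max(π): partitions μ with n positive parts
-- and μ_i ≤ π(i) (π(i) read 1-based, i.e. toℕ (π i) + 1)
λmaxFamily : ∀ {n} → Permutation′ n → (Fin n → ℕ) → Set
λmaxFamily π μ = IsPartition μ × PositiveParts μ × (∀ i → μ i ≤ℕ suc (toℕ (π ⟨$⟩ʳ i)))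

-- λ_i = ρ_{π(i)}, with ρ taking values in {1,…,n} encoded as Fin n (k ↦ k+1)
lambdaOf : ∀ {n} → Permutation′ n → (Fin n → Fin n) → Fin n → ℕ
lambdaOf π ρ i = suc (toℕ (ρ (π ⟨$⟩ʳ i)))

-- Geometry, over a dense linear order O (ℝ is an instance).
-- W : Fin (suc n) → Carrier, W zero = W₀ = 0 (the origin).

module Geometry {c ℓ₁ ℓ₂ : Level} (O : DenseLinearOrder c ℓ₁ ℓ₂) where
  open DenseLinearOrder O public using (Carrier; _≈_; _<_)
  open StrictToNonStrict _≈_ _<_ public using (_≤_)

  StrictlyIncreasing : ∀ {n} → (Fin (suc n) → Carrier) → Set ℓ₂
  StrictlyIncreasing {n} W = ∀ (i : Fin n) → W (inject₁ i) < W (suc i)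

  InB : ∀ {n} → (Fin (suc n) → Carrier) → (Fin n → Carrier) → Set (ℓ₁ Level.⊔ ℓ₂)
  InB W x = ∀ j → (W zero ≤ x j) × (x j ≤ W (suc j))

  InC : ∀ {n} → (Fin (suc n) → Carrier) → Permutation′ n → (Fin n → Carrier) → Set (ℓ₁ Level.⊔ ℓ₂)
  InC W π x = InB W x × (∀ i i′ → i Fin.≤ i′ → x (π ⟨$⟩ʳ i′) ≤ x (π ⟨$⟩ʳ i))

  InBρ : ∀ {n} → (Fin (suc n) → Carrier) → (Fin n → Fin n) → (Fin n → Carrier) → Set ℓ₂
  InBρ W ρ x = ∀ j → (W (inject₁ (ρ j)) < x j) × (x j < W (suc (ρ j)))

  CapNonempty : ∀ {n} → (Fin (suc n) → Carrier) → Permutation′ n → (Fin n → Fin n) → Set (c Level.⊔ ℓ₁ Level.⊔ ℓ₂)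
  CapNonempty W π ρ = ∃[ x ] (InC W π x × InBρ W ρ x)

-- Write I_k = (W_{k-1}, W_k), so that x ∈ B_ρ means x_j ∈ I_{ρ_j} for every j.
-- The intervals are disjoint and ordered like their indices, so on B_ρ the
-- order of the coordinates determines the order of the ρ_j: being
-- non-increasing along π forces λ to be a partition, and x_j ≤ W_j forces
-- ρ_j ≤ j. Conversely, if λ is a partition and ρ_j ≤ j, pick a point p_k in
-- every I_k by density; x_j = p_{ρ_j} lies in C_π ∩ B_ρ. Finally, for a
-- partition λ with positive parts, λ ⊆ λ^max(π) says exactly λ_i ≤ π(i), that
-- is ρ_j ≤ j: λ is itself a member of the family, and no member has a row
-- longer than π(i).
module Submission where

open import Defs
open import Data.Nat using (ℕ; suc; _≤_)
open import Data.Fin using (Fin)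
open import Data.Fin.Permutation using (Permutation′)
open import Data.Product using (_×_)
open import Function.Bundles using (_⇔_)
open import Relation.Binary.Bundles using (DenseLinearOrder)

open import Level using (Level)
open import Data.Nat using (zero; z≤n; s≤s; s≤s⁻¹)
import Data.Nat.Properties as ℕ
open import Data.Fin as Fin using (zero; suc; toℕ; inject₁)
import Data.Fin.Properties as Fin
open import Data.Fin.Permutation using (_⟨$⟩ʳ_; _⟨$⟩ˡ_; inverseʳ)
open import Data.Product using (_,_; proj₁; proj₂)
open import Data.Sum using (inj₁; inj₂)
open import Function.Base using (_∘_)
open import Function.Bundles using (mk⇔; Equivalence)
open import Relation.Binary.Core using (Rel)
open import Relation.Binary.Definitions using (Transitive)
open import Relation.Binary.PropositionalEquality using (sym; cong; subst)
open import Relation.Nullary using (yes; no; contradiction)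

chain-< : ∀ {a ℓ} {A : Set a} {R : Rel A ℓ} → Transitive R →
          ∀ {n} {f : Fin (suc n) → A} → (∀ i → R (f (inject₁ i)) (f (suc i))) →
          ∀ {i j} → i Fin.< j → R (f i) (f j)
chain-< trans step {i = zero} {suc zero} _ = step zero
chain-< {R = R} trans {f = f} step {i = zero} {suc (suc j)} _ =
  trans (step zero) (chain-< {R = R} trans {f = f ∘ suc} (λ i → step (suc i)) {zero} {suc j} (s≤s z≤n))
chain-< {R = R} trans {n = suc _} {f} step {suc i} {suc j} (s≤s i<j) =
  chain-< {R = R} trans {f = f ∘ suc} (λ i → step (suc i)) i<j

permute-∀ : ∀ {n p} {P : Fin n → Set p} (π : Permutation′ n) → (∀ i → P (π ⟨$⟩ʳ i)) → ∀ j → P j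
permute-∀ {P = P} π P∘π j = subst P (inverseʳ π) (P∘π (π ⟨$⟩ˡ j))

⊆⋃-row≤ : ∀ {n} {S : (Fin n → ℕ) → Set} {lam : Fin n → ℕ} {i : Fin n} {b : ℕ} →
          (∀ {μ} → S μ → μ i ≤ b) → lam ⊆⋃ S → lam i ≤ b
⊆⋃-row≤ {lam = lam} {i} rows≤b lam⊆⋃S with lam i in lamᵢ≡
... | zero  = z≤n
... | suc k with lam⊆⋃S (i , k) (subst (suc k ≤_) (sym lamᵢ≡) ℕ.≤-refl)
...   | _ , Sμ , k<μᵢ = ℕ.≤-trans k<μᵢ (rows≤b Sμ)

⊆⋃λmax⇔rows≤ : ∀ {n} (π : Permutation′ n) {lam : Fin n → ℕ} → IsPartition lam → PositiveParts lam →
               lam ⊆⋃ λmaxFamily π ⇔ (∀ i → lam i ≤ suc (toℕ (π ⟨$⟩ʳ i)))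
⊆⋃λmax⇔rows≤ π {lam} part pos = mk⇔
  (λ lam⊆⋃ i → ⊆⋃-row≤ (λ (_ , _ , μ≤π) → μ≤π i) lam⊆⋃)
  (λ lam≤π _ c∈lam → lam , (part , pos , lam≤π) , c∈lam)

module Intervals {c ℓ₁ ℓ₂ : Level} (O : DenseLinearOrder c ℓ₁ ℓ₂) {n : ℕ}
  (W : Fin (suc n) → DenseLinearOrder.Carrier O) (W-increasing : Geometry.StrictlyIncreasing O W) where

  open DenseLinearOrder O using (Carrier; _<_; trans; irrefl; dense; strictPartialOrder; module Eq)
  open Geometry O using (InB; CapNonempty) renaming (_≤_ to _⊑_)
  open import Relation.Binary.Reasoning.StrictPartialOrder strictPartialOrder

  -- x ∈I k is the header's x ∈ I_{k+1}; InBρ W ρ x unfolds to ∀ j → x j ∈I ρ j.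
  _∈I_ : Carrier → Fin n → Set ℓ₂
  x ∈I k = W (inject₁ k) < x × x < W (suc k)

  W-mono-< : ∀ {a b} → a Fin.< b → W a < W b
  W-mono-< = chain-< {R = _<_} trans W-increasing

  W-mono-≤ : ∀ {a b} → a Fin.≤ b → W a ⊑ W b
  W-mono-≤ a≤b with ℕ.m≤n⇒m<n∨m≡n a≤b
  ... | inj₁ a<b = inj₁ (W-mono-< a<b)
  ... | inj₂ a≡b = inj₂ (Eq.reflexive (cong W (Fin.toℕ-injective a≡b)))

  upper≤lower : ∀ {k k′} → k Fin.< k′ → W (suc k) ⊑ W (inject₁ k′)
  upper≤lower {k′ = k′} k<k′ = W-mono-≤ (subst (suc (toℕ _) ≤_) (sym (Fin.toℕ-inject₁ k′)) k<k′)

  lower<x≤upper⇒≤ : ∀ {k k′ x} → W (inject₁ k) < x → x ⊑ W (suc k′) → k Fin.≤ k′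
  lower<x≤upper⇒≤ {k} {k′} {x} below above with k Fin.≤? k′
  ... | yes k≤k′ = k≤k′
  ... | no  k≰k′ = contradiction x<x (irrefl Eq.refl)
    where
    x<x : x < x
    x<x = begin-strict
      x             ≤⟨ above ⟩
      W (suc k′)    ≤⟨ upper≤lower (ℕ.≰⇒> k≰k′) ⟩
      W (inject₁ k) <⟨ below ⟩
      x             ∎

  ∈I-mono : ∀ {k k′ x y} → k Fin.< k′ → x ∈I k → y ∈I k′ → x < y
  ∈I-mono {k} {k′} {x} {y} k<k′ (_ , x<upper) (lower<y , _) = begin-strict
    x              <⟨ x<upper ⟩
    W (suc k)      ≤⟨ upper≤lower k<k′ ⟩
    W (inject₁ k′) <⟨ lower<y ⟩
    y              ∎

  point : Fin n → Carrier
  point k = proj₁ (dense (W-increasing k))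

  point-∈I : ∀ k → point k ∈I k
  point-∈I k = proj₂ (dense (W-increasing k))

  point-mono : ∀ {k k′} → k Fin.≤ k′ → point k ⊑ point k′
  point-mono k≤k′ with ℕ.m≤n⇒m<n∨m≡n k≤k′
  ... | inj₁ k<k′ = inj₁ (∈I-mono k<k′ (point-∈I _) (point-∈I _))
  ... | inj₂ k≡k′ = inj₂ (Eq.reflexive (cong point (Fin.toℕ-injective k≡k′)))

  capNonempty⇒ : ∀ {π ρ} → CapNonempty W π ρ → IsPartition (lambdaOf π ρ) × (∀ j → ρ j Fin.≤ j)
  capNonempty⇒ {π} {ρ} (x , (x∈B , x∘π-antitone) , x∈Bρ) = partition , ρ≤id
    where
    partition : IsPartition (lambdaOf π ρ)
    partition i i′ i≤i′ = s≤s (lower<x≤upper⇒≤ (proj₁ (x∈Bρ (π ⟨$⟩ʳ i′))) (begin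
      x (π ⟨$⟩ʳ i′)           ≤⟨ x∘π-antitone i i′ i≤i′ ⟩
      x (π ⟨$⟩ʳ i)            <⟨ proj₂ (x∈Bρ (π ⟨$⟩ʳ i)) ⟩
      W (suc (ρ (π ⟨$⟩ʳ i))) ∎))

    ρ≤id : ∀ j → ρ j Fin.≤ j
    ρ≤id j = lower<x≤upper⇒≤ (proj₁ (x∈Bρ j)) (proj₂ (x∈B j))

  capNonempty⇐ : ∀ {π ρ} → IsPartition (lambdaOf π ρ) → (∀ j → ρ j Fin.≤ j) → CapNonempty W π ρ
  capNonempty⇐ {π} {ρ} partition ρ≤id = x , (x∈B , x∘π-antitone) , λ j → point-∈I (ρ j)
    where
    x : Fin n → Carrier
    x j = point (ρ j)

    x∈B : InB W x
    x∈B j = (begin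
      W zero            ≤⟨ W-mono-≤ z≤n ⟩
      W (inject₁ (ρ j)) <⟨ proj₁ (point-∈I (ρ j)) ⟩
      x j               ∎) , (begin
      x j               <⟨ proj₂ (point-∈I (ρ j)) ⟩
      W (suc (ρ j))     ≤⟨ W-mono-≤ (s≤s (ρ≤id j)) ⟩
      W (suc j)         ∎)

    x∘π-antitone : ∀ i i′ → i Fin.≤ i′ → x (π ⟨$⟩ʳ i′) ⊑ x (π ⟨$⟩ʳ i)
    x∘π-antitone i i′ i≤i′ = point-mono (s≤s⁻¹ (partition i i′ i≤i′))

lemma4 : ∀ {c ℓ₁ ℓ₂} (O : DenseLinearOrder c ℓ₁ ℓ₂) (n : ℕ) → 1 ≤ n →
         (W : Fin (suc n) → DenseLinearOrder.Carrier O) → Geometry.StrictlyIncreasing O W →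
         (π : Permutation′ n) (ρ : Fin n → Fin n) →
         Geometry.CapNonempty O W π ρ ⇔ (IsPartition (lambdaOf π ρ) × (lambdaOf π ρ ⊆⋃ λmaxFamily π))
lemma4 O n _ W W-increasing π ρ = mk⇔
  (λ cap → let partition , ρ≤id = capNonempty⇒ {π} {ρ} cap in
    partition , from (⊆λmax⇔ partition) (λ i → s≤s (ρ≤id (π ⟨$⟩ʳ i))))
  (λ (partition , λ⊆λmax) →
    capNonempty⇐ {π} {ρ} partition (permute-∀ π (λ i → s≤s⁻¹ (to (⊆λmax⇔ partition) λ⊆λmax i))))
  where
  open Intervals O W W-increasing
  open Equivalence using (to; from)

  ⊆λmax⇔ : IsPartition (lambdaOf π ρ) →
           lambdaOf π ρ ⊆⋃ λmaxFamily π ⇔ (∀ i → lambdaOf π ρ i ≤ suc (toℕ (π ⟨$⟩ʳ i)))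
  ⊆λmax⇔ partition = ⊆⋃λmax⇔rows≤ π partition (λ _ → s≤s z≤n)
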